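{- Let $A,B,k$ be positive integers with $\min\{A,B,k\}>1$ and $\gcd(A,B)=1$. Then the equation $A^m+B^n=k$ has at most two solutions $(m,n)$ in positive integers. -}

module Defs where

open import Data.Nat using (ℕ; _+_; _^_; _<_)
open import Data.Product using (_×_)
open import Relation.Binary.PropositionalEquality using (_≡_)

IsSolution : ℕ → ℕ → ℕ → ℕ × ℕ → Set
IsSolution A B k (m Data.Product., n) = (0 < m) × (0 < n) × (A ^ m + B ^ n ≡ k)

-- For two solutions with m < m', subtracting the equations gives
-- A^m (A^p − 1) = B^n' (B^q − 1) with m' = m + p, n = n' + q; since A and B are
-- coprime, A^m divides B^q − 1, so A^m < B^n, and symmetrically B^n' < A^m'.
-- So of two distinct solutions exactly one satisfies A^m < B^n, and by the
-- pigeonhole principle no three solutions are pairwise distinct.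
module Submission where

open import Defs
open import Data.Bool using (Bool; true; false)
open import Data.Nat using (ℕ; suc; _+_; _*_; _^_; _∸_; _≤_; _<_; _<?_; s≤s; z<s; NonZero; >-nonZero)
open import Data.Nat.Properties
open import Data.Nat.Divisibility using (_∣_; divides; ∣-refl; ∣-trans; ∣1⇒≡1; ∣⇒≤; ∣m+n∣m⇒∣n)
open import Data.Nat.Coprimality using (Coprime; coprime-divisor; gcd≡1⇒coprime)
import Data.Nat.Coprimality as Coprime
open import Data.Nat.GCD using (gcd)
open import Data.Nat.Solver using (module +-*-Solver)
open import Data.Product using (_×_; _,_)
open import Data.Sum using (_⊎_; inj₁; inj₂)
import Data.Sum as Sum
open import Relation.Binary using (tri<; tri≈; tri>)
open import Relation.Binary.PropositionalEquality using (_≡_; _≢_; refl; sym; trans; cong; module ≡-Reasoning)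
open import Relation.Nullary using (yes; no; does; contradiction)
open import Relation.Nullary.Decidable using (dec-true; dec-false)

coprime-^ʳ : ∀ {m n} k → Coprime m n → Coprime m (n ^ k)
coprime-^ʳ 0       _     (_ , d∣1)      = ∣1⇒≡1 d∣1
coprime-^ʳ {n = n} (suc k) m⊥n {d} (d∣m , d∣nnᵏ) =
  coprime-^ʳ k m⊥n (d∣m , coprime-divisor d⊥n d∣nnᵏ)
  where
  d⊥n : Coprime d n
  d⊥n (e∣d , e∣n) = m⊥n (∣-trans e∣d d∣m , e∣n)

coprime-^ : ∀ {m n} j k → Coprime m n → Coprime (m ^ j) (n ^ k)
coprime-^ j k m⊥n = coprime-^ʳ k (Coprime.sym (coprime-^ʳ j (Coprime.sym m⊥n)))

^-injectiveʳ : ∀ {b m n} → 1 < b → b ^ m ≡ b ^ n → m ≡ n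
^-injectiveʳ {b} {m} {n} 1<b bᵐ≡bⁿ with <-cmp m n
... | tri< m<n _ _ = contradiction bᵐ≡bⁿ (<⇒≢ (^-monoʳ-< b 1<b m<n))
... | tri≈ _ m≡n _ = m≡n
... | tri> _ _ m>n = contradiction bᵐ≡bⁿ (>⇒≢ (^-monoʳ-< b 1<b m>n))

-- From a + b c = a d + b we get a d = a + b (c − 1), so a ∣ b (c − 1), hence a ∣ c − 1.
coprime-exchange-< : ∀ {a b c d} → Coprime a b → 1 < c → a + b * c ≡ a * d + b → a < c
coprime-exchange-< {a} {b} {suc c} {d} a⊥b (s≤s 0<c) eq =
  s≤s (∣⇒≤ {{>-nonZero 0<c}} (coprime-divisor a⊥b a∣bc))
  where
  open +-*-Solver
  ad≡a+bc : a * d ≡ a + b * c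
  ad≡a+bc = sym (+-cancelʳ-≡ b _ _ (trans
    (solve 3 (λ a b c → (a :+ b :* c) :+ b := a :+ b :* (con 1 :+ c)) refl a b c) eq))
  a∣bc : a ∣ b * c
  a∣bc = ∣m+n∣m⇒∣n (divides d (trans (sym ad≡a+bc) (*-comm a d))) ∣-refl

exponents-antitone : ∀ {A B m n m' n'} .{{_ : NonZero B}} → 1 < A →
                     A ^ m + B ^ n ≡ A ^ m' + B ^ n' → m < m' → n' < n
exponents-antitone {A} {B} {m} {n} {m'} {n'} 1<A eq m<m' with n' <? n
... | yes n'<n = n'<n
... | no n'≮n  = contradiction eq
                   (<⇒≢ (+-mono-<-≤ (^-monoʳ-< A 1<A m<m') (^-monoʳ-≤ B (≮⇒≥ n'≮n))))

coprime-exchange-^-< : ∀ {A B m n m' n'} → Coprime A B → 1 < B → m ≤ m' → n' < n →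
                       A ^ m + B ^ n ≡ A ^ m' + B ^ n' → A ^ m < B ^ n
coprime-exchange-^-< {A} {B} {m} {n} {m'} {n'} A⊥B 1<B m≤m' n'<n eq =
  <-≤-trans (coprime-exchange-< (coprime-^ m n' A⊥B) 1<Bᵠ exchanged)
            (^-monoʳ-≤ B {{>-nonZero (<-trans z<s 1<B)}} (m∸n≤m n n'))
  where
  p = m' ∸ m
  q = n ∸ n'
  1<Bᵠ : 1 < B ^ q
  1<Bᵠ = ^-monoʳ-< B 1<B (m<n⇒0<n∸m n'<n)
  open ≡-Reasoning
  exchanged : A ^ m + B ^ n' * B ^ q ≡ A ^ m * A ^ p + B ^ n'
  exchanged = begin
    A ^ m + B ^ n' * B ^ q ≡⟨ cong (A ^ m +_) (sym (^-distribˡ-+-* B n' q)) ⟩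
    A ^ m + B ^ (n' + q)   ≡⟨ cong (λ e → A ^ m + B ^ e) (m+[n∸m]≡n (<⇒≤ n'<n)) ⟩
    A ^ m + B ^ n          ≡⟨ eq ⟩
    A ^ m' + B ^ n'        ≡⟨ cong (λ e → A ^ e + B ^ n') (sym (m+[n∸m]≡n m≤m')) ⟩
    A ^ (m + p) + B ^ n'   ≡⟨ cong (_+ B ^ n') (^-distribˡ-+-* A m p) ⟩
    A ^ m * A ^ p + B ^ n' ∎

bool-pigeonhole : (x y z : Bool) → x ≡ y ⊎ x ≡ z ⊎ y ≡ z
bool-pigeonhole true  true  _     = inj₁ refl
bool-pigeonhole false false _     = inj₁ refl
bool-pigeonhole true  false true  = inj₂ (inj₁ refl)
bool-pigeonhole false true  false = inj₂ (inj₁ refl)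
bool-pigeonhole _     false false = inj₂ (inj₂ refl)
bool-pigeonhole _     true  true  = inj₂ (inj₂ refl)

module Solutions {A B : ℕ} (1<A : 1 < A) (1<B : 1 < B) (A⊥B : Coprime A B) where

  firstPowerSmaller : ℕ × ℕ → Bool
  firstPowerSmaller (m , n) = does (A ^ m <? B ^ n)

  ordered-solutions-powers : ∀ {k m n m' n'} → IsSolution A B k (m , n) → IsSolution A B k (m' , n') →
                             m < m' → A ^ m < B ^ n × B ^ n' < A ^ m'
  ordered-solutions-powers {m = m} {n} {m'} {n'} (_ , _ , e) (_ , _ , e') m<m' =
    coprime-exchange-^-< A⊥B 1<B (<⇒≤ m<m') n'<n eq ,
    coprime-exchange-^-< (Coprime.sym A⊥B) 1<A (<⇒≤ n'<n) m<m' swapped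
    where
    eq : A ^ m + B ^ n ≡ A ^ m' + B ^ n'
    eq = trans e (sym e')
    n'<n : n' < n
    n'<n = exponents-antitone {{>-nonZero (<-trans z<s 1<B)}} 1<A eq m<m'
    swapped : B ^ n' + A ^ m' ≡ B ^ n + A ^ m
    swapped = trans (+-comm (B ^ n') (A ^ m')) (trans (sym eq) (+-comm (A ^ m) (B ^ n)))

  ordered-solutions-separated : ∀ {k m n m' n'} → IsSolution A B k (m , n) → IsSolution A B k (m' , n') →
                                m < m' → firstPowerSmaller (m , n) ≢ firstPowerSmaller (m' , n')
  ordered-solutions-separated {m = m} {n} {m'} {n'} s s' m<m' same
    with ordered-solutions-powers s s' m<m'
  ... | Aᵐ<Bⁿ , Bⁿ'<Aᵐ' =
    contradiction (trans (sym (dec-true (A ^ m <? B ^ n) Aᵐ<Bⁿ))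
                         (trans same (dec-false (A ^ m' <? B ^ n') (<-asym Bⁿ'<Aᵐ'))))
                  λ ()

  firstPowerSmaller-injective : ∀ {k s s'} → IsSolution A B k s → IsSolution A B k s' →
                                firstPowerSmaller s ≡ firstPowerSmaller s' → s ≡ s'
  firstPowerSmaller-injective {s = m , n} {m' , n'} h h' same with <-cmp m m'
  ... | tri< m<m' _ _ = contradiction same (ordered-solutions-separated h h' m<m')
  ... | tri> _ _ m>m' = contradiction (sym same) (ordered-solutions-separated h' h m>m')
  ... | tri≈ _ refl _ with h | h'
  ...   | _ , _ , e | _ , _ , e' = cong (m ,_) (^-injectiveʳ 1<B (+-cancelˡ-≡ (A ^ m) _ _ (trans e (sym e'))))

lemma3p4 : (A B k : ℕ) → 1 < A → 1 < B → 1 < k → gcd A B ≡ 1 →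
           (s₁ s₂ s₃ : ℕ × ℕ) →
           IsSolution A B k s₁ → IsSolution A B k s₂ → IsSolution A B k s₃ →
           (s₁ ≡ s₂) ⊎ (s₁ ≡ s₃) ⊎ (s₂ ≡ s₃)
lemma3p4 A B k 1<A 1<B _ gcd≡1 s₁ s₂ s₃ h₁ h₂ h₃ =
  Sum.map (injective h₁ h₂) (Sum.map (injective h₁ h₃) (injective h₂ h₃))
    (bool-pigeonhole (firstPowerSmaller s₁) (firstPowerSmaller s₂) (firstPowerSmaller s₃))
  where
  open Solutions 1<A 1<B (gcd≡1⇒coprime gcd≡1)
    renaming (firstPowerSmaller-injective to injective)
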